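{- Let $m,n$ be nonnegative integers. (1) Suppose $(x,y,z,t)$ are integers with $m=x^{2}+y^{2}+z^{2}+t^{2}$ and $n=x+4y$, and at least one of $x-y-z$, $x-y+z$, $x-y+t$, $x-y-t$ is divisible by $3$. Then there exist integers $x',y',z',t'$ with $m=x'^{2}+y'^{2}+z'^{2}+t'^{2}$ and $n=2x'+2y'+3z'$. (2) Suppose $(x,y,z,t)$ are integers with $m=x^{2}+y^{2}+z^{2}+t^{2}$ and $n=2x+5y$, and at least one of $x-y-z$, $x-y+z$, $x-y+t$, $x-y-t$ is divisible by $3$. Then there exist integers $x',y',z',t'$ with $m=x'^{2}+y'^{2}+z'^{2}+t'^{2}$ and $n=2x'+3y'+4z'$. -}

module Defs where

open import Data.Integer using (ℤ; _+_; _*_)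

sq4 : ℤ → ℤ → ℤ → ℤ → ℤ
sq4 x y z t = x * x + y * y + z * z + t * t

{-# OPTIONS --safe #-}
module Submission where

-- With e = (1, -1, -1), the reflection v ↦ v - (2 (v·e) / 3) e preserves x² + y² + u²,
-- and it is integral precisely when 3 ∣ x - y - u: writing x - y - u = 3k it sends
-- (x, y, u) to (x - 2k, y + 2k, u + 2k). Applied with u = ±z or ±t (the other
-- variable is carried along), a suitable ordering and signing of the image turns
-- x + 4y into 2x′ + 2y′ + 3z′ and 2x + 5y into 2x′ + 3y′ + 4z′.

open import Defs
open import Data.Nat using (ℕ)
open import Data.Integer using (ℤ; +_; _+_; _-_; _*_; -_)
open import Data.Integer.Properties using (+-comm; +-commutativeSemigroup)
open import Algebra.Properties.CommutativeSemigroup +-commutativeSemigroup using (xy∙z≈xz∙y)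
open import Data.Integer.Divisibility using (_∣_)
open import Data.Integer.Divisibility.Signed using (∣ᵤ⇒∣; divides)
open import Data.Integer.Tactic.RingSolver using (solve-∀)
open import Data.Product using (_×_; ∃-syntax; _,_)
open import Data.Sum using (_⊎_; inj₁; inj₂)
open import Relation.Binary.PropositionalEquality using (_≡_; refl; sym; trans; cong; subst)

neg-square : ∀ i → - i * - i ≡ i * i
neg-square = solve-∀

sq4-neg₃ : ∀ x y z t → sq4 x y (- z) t ≡ sq4 x y z t
sq4-neg₃ x y z t = cong (λ s → x * x + y * y + s + t * t) (neg-square z)

sq4-swap₃₄ : ∀ x y z t → sq4 x y t z ≡ sq4 x y z t
sq4-swap₃₄ x y z t = xy∙z≈xz∙y (x * x + y * y) (t * t) (z * z)

sq4-swap₁₂ : ∀ x y z t → sq4 y x z t ≡ sq4 x y z t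
sq4-swap₁₂ x y z t = cong (λ s → s + z * z + t * t) (+-comm (y * y) (x * x))

x-y+z≡x-y-[-z] : ∀ x y z → x - y + z ≡ x - y - (- z)
x-y+z≡x-y-[-z] = solve-∀

x≡[x-y-u]+y+u : ∀ x y u → x ≡ (x - y - u) + y + u
x≡[x-y-u]+y+u = solve-∀

x-y-u≡3k⇒x≡3k+y+u : ∀ {x y u k} → x - y - u ≡ k * + 3 → x ≡ k * + 3 + y + u
x-y-u≡3k⇒x≡3k+y+u {x} {y} {u} eq = trans (x≡[x-y-u]+y+u x y u) (cong (λ d → d + y + u) eq)

reflect-sum-of-squares : ∀ k y u →
  (k * + 3 + y + u) * (k * + 3 + y + u) + y * y + u * u
    ≡ (y + + 2 * k) * (y + + 2 * k) + - (u + + 2 * k) * - (u + + 2 * k)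
      + (k * + 3 + y + u - + 2 * k) * (k * + 3 + y + u - + 2 * k)
reflect-sum-of-squares = solve-∀

reflect-form₁ : ∀ k y u →
  (k * + 3 + y + u) + + 4 * y
    ≡ + 2 * (y + + 2 * k) + + 2 * (- (u + + 2 * k)) + + 3 * (k * + 3 + y + u - + 2 * k)
reflect-form₁ = solve-∀

reflect-form₂ : ∀ k y u →
  + 2 * (k * + 3 + y + u) + + 5 * y
    ≡ + 2 * (- (u + + 2 * k)) + + 3 * (y + + 2 * k) + + 4 * (k * + 3 + y + u - + 2 * k)
reflect-form₂ = solve-∀

reflect : ∀ x y u t → + 3 ∣ x - y - u →
  ∃[ a ] ∃[ b ] ∃[ c ]
    (sq4 x y u t ≡ sq4 a b c t
    × x + + 4 * y ≡ + 2 * a + + 2 * b + + 3 * c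
    × + 2 * x + + 5 * y ≡ + 2 * b + + 3 * a + + 4 * c)
reflect x y u t 3∣x-y-u with ∣ᵤ⇒∣ 3∣x-y-u
... | divides k x-y-u≡3k with x-y-u≡3k⇒x≡3k+y+u {x} {y} {u} {k} x-y-u≡3k
... | refl = y + + 2 * k , - (u + + 2 * k) , k * + 3 + y + u - + 2 * k
           , cong (_+ t * t) (reflect-sum-of-squares k y u) , reflect-form₁ k y u , reflect-form₂ k y u

one-divisible-difference : ∀ x y z t →
  (+ 3 ∣ x - y - z) ⊎ (+ 3 ∣ x - y + z) ⊎ (+ 3 ∣ x - y + t) ⊎ (+ 3 ∣ x - y - t) →
  ∃[ u ] ∃[ w ] (sq4 x y u w ≡ sq4 x y z t × + 3 ∣ x - y - u)
one-divisible-difference x y z t (inj₁ 3∣x-y-z) = z , t , refl , 3∣x-y-z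
one-divisible-difference x y z t (inj₂ (inj₁ 3∣x-y+z)) =
  - z , t , sq4-neg₃ x y z t , subst (+ 3 ∣_) (x-y+z≡x-y-[-z] x y z) 3∣x-y+z
one-divisible-difference x y z t (inj₂ (inj₂ (inj₁ 3∣x-y+t))) =
  - t , z , trans (sq4-neg₃ x y t z) (sq4-swap₃₄ x y z t) , subst (+ 3 ∣_) (x-y+z≡x-y-[-z] x y t) 3∣x-y+t
one-divisible-difference x y z t (inj₂ (inj₂ (inj₂ 3∣x-y-t))) =
  t , z , sq4-swap₃₄ x y z t , 3∣x-y-t

reflect-sq4 : ∀ x y z t →
  (+ 3 ∣ x - y - z) ⊎ (+ 3 ∣ x - y + z) ⊎ (+ 3 ∣ x - y + t) ⊎ (+ 3 ∣ x - y - t) →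
  ∃[ a ] ∃[ b ] ∃[ c ] ∃[ w ]
    (sq4 x y z t ≡ sq4 a b c w
    × x + + 4 * y ≡ + 2 * a + + 2 * b + + 3 * c
    × + 2 * x + + 5 * y ≡ + 2 * b + + 3 * a + + 4 * c)
reflect-sq4 x y z t 3∣ =
  let u , w , sq-uw , 3∣x-y-u = one-divisible-difference x y z t 3∣
      a , b , c , sq-abc , form₁ , form₂ = reflect x y u w 3∣x-y-u
  in a , b , c , w , trans (sym sq-uw) sq-abc , form₁ , form₂

lemma3p5 : (m n : ℕ) →
    ((x y z t : ℤ) → + m ≡ sq4 x y z t → + n ≡ x + + 4 * y →
      (+ 3 ∣ x - y - z) ⊎ (+ 3 ∣ x - y + z) ⊎ (+ 3 ∣ x - y + t) ⊎ (+ 3 ∣ x - y - t) →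
      ∃[ x′ ] ∃[ y′ ] ∃[ z′ ] ∃[ t′ ] (+ m ≡ sq4 x′ y′ z′ t′ × + n ≡ + 2 * x′ + + 2 * y′ + + 3 * z′))
    ×
    ((x y z t : ℤ) → + m ≡ sq4 x y z t → + n ≡ + 2 * x + + 5 * y →
      (+ 3 ∣ x - y - z) ⊎ (+ 3 ∣ x - y + z) ⊎ (+ 3 ∣ x - y + t) ⊎ (+ 3 ∣ x - y - t) →
      ∃[ x′ ] ∃[ y′ ] ∃[ z′ ] ∃[ t′ ] (+ m ≡ sq4 x′ y′ z′ t′ × + n ≡ + 2 * x′ + + 3 * y′ + + 4 * z′))
lemma3p5 m n =
  (λ x y z t m≡ n≡ 3∣ →
    let a , b , c , w , sq≡ , form₁ , _ = reflect-sq4 x y z t 3∣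
    in a , b , c , w , trans m≡ sq≡ , trans n≡ form₁)
  ,
  (λ x y z t m≡ n≡ 3∣ →
    let a , b , c , w , sq≡ , _ , form₂ = reflect-sq4 x y z t 3∣
    in b , a , c , w , trans m≡ (trans sq≡ (sq4-swap₁₂ b a c w)) , trans n≡ form₂)
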